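{- Let $x$ be a sequence of pairwise distinct integers of length $m$, let $i\in\{1,\ldots,m-1\}$ and $y=\tau(x,i)$. Suppose $x[i]<x[i+1]$. Then: (1) $\overleftarrow{PD}_y[i]=1$; (2) $\overrightarrow{PD}_y[i+1]=0$ if $\overrightarrow{PD}_x[i]=0$, and $\overrightarrow{PD}_y[i+1]=\overrightarrow{PD}_x[i]+1$ otherwise; (3) $\overleftarrow{PD}_y[i+1]=0$ if $\overleftarrow{PD}_x[i]=0$, and $\overleftarrow{PD}_y[i+1]=\overleftarrow{PD}_x[i]-1$ otherwise; (4) $\overrightarrow{PD}_y[i]\le i-1$ if $\overrightarrow{PD}_x[i]=0$, and $\overrightarrow{PD}_y[i]\le \overrightarrow{PD}_x[i]$ otherwise.
   Context: All sequences consist of pairwise distinct integers. For $1\le i\le m-1$, $\tau(x,i)$ is the sequence obtained from $x$ by exchanging $x[i]$ and $x[i+1]$. The parent-distance representation of $x[1\ldots m]$ is $\overrightarrow{PD}_x[h]=h-\max\{j<h: x[j]<x[h]\}$ if such $j$ exists and $0$ otherwise. The reverse parent-distance representation is $\overleftarrow{PD}_x[h]=\min\{j>h: x[j]<x[h]\}-h$ if such $j$ exists and $0$ otherwise. -}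

module Defs where

open import Data.Nat using (ℕ; zero; suc; _∸_; _+_)
open import Data.Integer using (ℤ; _<?_)
open import Data.Bool using (if_then_else_)
open import Relation.Nullary.Decidable using (does)
open import Data.Nat using () renaming (_≟_ to _≟ℕ_)

-- A sequence x[1..m] is a function ℕ → ℤ; only positions 1..m are used.

τ : (ℕ → ℤ) → ℕ → (ℕ → ℤ)
τ x i k = if does (k ≟ℕ i) then x (suc i)
          else if does (k ≟ℕ suc i) then x i
          else x k

fwdSearch : (ℕ → ℤ) → ℕ → ℕ → ℕ
fwdSearch x h zero = 0
fwdSearch x h (suc k) =
  if does (x (suc k) <? x h) then h ∸ suc k else fwdSearch x h k

-- Forward parent distance: PD→_x[h] = h - max{j < h : x[j] < x[h]}, or 0.
fwdPD : (ℕ → ℤ) → ℕ → ℕ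
fwdPD x h = fwdSearch x h (h ∸ 1)

revSearch : (ℕ → ℤ) → ℕ → ℕ → ℕ → ℕ
revSearch x h j zero = 0
revSearch x h j (suc n) =
  if does (x j <? x h) then j ∸ h else revSearch x h (suc j) n

-- Reverse parent distance for a sequence of length m:
-- PD←_x[h] = min{j > h (j ≤ m) : x[j] < x[h]} - h, or 0.
revPD : ℕ → (ℕ → ℤ) → ℕ → ℕ
revPD m x h = revSearch x h (suc h) (m ∸ h)

-- Both parent distances are read off from a search for the nearest position, to the left
-- or to the right of h, whose value lies below a threshold (the value at h). The swap moves
-- x i to position i + 1 and leaves every other position outside {i, i + 1} unchanged, so the
-- searches for x i see the same sequence: its left parent stays where it was and is now one
-- step further away, and its right search merely skips the larger x (i + 1), finding the same
-- parent one step closer. The value x (i + 1), moved to position i, has x i right behind it,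
-- and its left search uses a larger threshold than that of x i, so it stops no further left.
module Submission where

open import Defs
open import Data.Bool using (true; false; if_then_else_)
open import Data.Nat using (ℕ; zero; suc; _+_; _≤_; _∸_; z≤n; s≤s; _≟_)
open import Data.Nat.Properties
  using ( ≤-refl; <⇒≤; n<1+n; m≤n⇒m≤1+n; <⇒≢; >⇒≢; <-trans; +-comm
        ; ∸-monoʳ-≤; ∸-+-assoc; +-∸-assoc; m+n∸n≡m; m>n⇒m∸n≢0; 0∸n≡0)
open import Data.Integer using (ℤ; _<_; _<?_)
import Data.Integer.Properties as ℤ
open import Data.Product using (_×_; _,_)
open import Relation.Binary.PropositionalEquality
  using (_≡_; _≢_; refl; sym; trans; cong; module ≡-Reasoning)
open import Relation.Nullary using (¬_; yes; no; does; contradiction)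
open import Relation.Nullary.Decidable using (dec-true; dec-false)

τ-at : ∀ x i → τ x i i ≡ x (suc i)
τ-at x i rewrite dec-true (i ≟ i) refl = refl

τ-at-suc : ∀ x i → τ x i (suc i) ≡ x i
τ-at-suc x i rewrite dec-false (suc i ≟ i) (>⇒≢ (n<1+n i)) | dec-true (suc i ≟ suc i) refl = refl

τ-elsewhere : ∀ x i k → k ≢ i → k ≢ suc i → τ x i k ≡ x k
τ-elsewhere x i k k≢i k≢1+i rewrite dec-false (k ≟ i) k≢i | dec-false (k ≟ suc i) k≢1+i = refl

τ-before : ∀ x {i j} → suc j ≤ i → τ x i j ≡ x j
τ-before x {i} {j} j<i = τ-elsewhere x i j (<⇒≢ j<i) (<⇒≢ (m≤n⇒m≤1+n j<i))

τ-after : ∀ x {i j} → suc (suc i) ≤ j → τ x i j ≡ x j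
τ-after x {i} {j} 1+i<j = τ-elsewhere x i j (>⇒≢ (<-trans (n<1+n i) 1+i<j)) (>⇒≢ 1+i<j)

lastBelow : (ℕ → ℤ) → ℤ → ℕ → ℕ
lastBelow x v zero = zero
lastBelow x v (suc k) = if does (x (suc k) <? v) then suc k else lastBelow x v k

lastBelow≤ : ∀ x v k → lastBelow x v k ≤ k
lastBelow≤ x v zero = z≤n
lastBelow≤ x v (suc k) with does (x (suc k) <? v)
... | true = ≤-refl
... | false = m≤n⇒m≤1+n (lastBelow≤ x v k)

lastBelow-miss : ∀ x v k → ¬ x (suc k) < v → lastBelow x v (suc k) ≡ lastBelow x v k
lastBelow-miss x v k x≮v rewrite dec-false (x (suc k) <? v) x≮v = refl

lastBelow-cong : ∀ {x y} v k → (∀ j → j ≤ k → y j ≡ x j) → lastBelow y v k ≡ lastBelow x v k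
lastBelow-cong v zero y≗x = refl
lastBelow-cong {x} v (suc k) y≗x rewrite y≗x (suc k) ≤-refl =
  cong (if does (x (suc k) <? v) then suc k else_)
       (lastBelow-cong v k λ j j≤k → y≗x j (m≤n⇒m≤1+n j≤k))

lastBelow-mono : ∀ x {v w} k → v < w → lastBelow x v k ≤ lastBelow x w k
lastBelow-mono x zero v<w = z≤n
lastBelow-mono x {v} {w} (suc k) v<w with x (suc k) <? v | x (suc k) <? w
... | yes _ | yes _ = ≤-refl
... | yes x<v | no x≮w = contradiction (ℤ.<-trans x<v v<w) x≮w
... | no _ | yes _ = m≤n⇒m≤1+n (lastBelow≤ x v k)
... | no _ | no _ = lastBelow-mono x k v<w

-- h ∸ p, except that the sentinel position 0 (no parent) has distance 0.
fwdDistance : ℕ → ℕ → ℕ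
fwdDistance h zero = zero
fwdDistance h (suc j) = h ∸ suc j

fwdSearch≡fwdDistance : ∀ x h k → fwdSearch x h k ≡ fwdDistance h (lastBelow x (x h) k)
fwdSearch≡fwdDistance x h zero = refl
fwdSearch≡fwdDistance x h (suc k) with does (x (suc k) <? x h)
... | true = refl
... | false = fwdSearch≡fwdDistance x h k

fwdDistance≤pred : ∀ h p → fwdDistance h p ≤ h ∸ 1
fwdDistance≤pred h zero = z≤n
fwdDistance≤pred h (suc j) = ∸-monoʳ-≤ h (s≤s z≤n)

fwdDistance-antitone : ∀ {h p q} → fwdDistance h p ≢ 0 → p ≤ q → fwdDistance h q ≤ fwdDistance h p
fwdDistance-antitone {p = zero} d≢0 _ = contradiction refl d≢0
fwdDistance-antitone {h} {suc j} {suc k} _ p≤q = ∸-monoʳ-≤ h p≤q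

fwdDistance≡0 : ∀ {h p} → suc p ≤ h → fwdDistance h p ≡ 0 → p ≡ 0
fwdDistance≡0 {p = zero} _ _ = refl
fwdDistance≡0 {h} {suc j} p<h d≡0 = contradiction d≡0 (m>n⇒m∸n≢0 p<h)

fwdDistance-suc : ∀ {h p} → fwdDistance h p ≢ 0 → p ≤ h → fwdDistance (suc h) p ≡ suc (fwdDistance h p)
fwdDistance-suc {p = zero} d≢0 _ = contradiction refl d≢0
fwdDistance-suc {p = suc j} _ p≤h = +-∸-assoc 1 p≤h

firstBelow : (ℕ → ℤ) → ℤ → ℕ → ℕ → ℕ
firstBelow x v j zero = zero
firstBelow x v j (suc n) = if does (x j <? v) then j else firstBelow x v (suc j) n

firstBelow-hit : ∀ x {v} j n → x j < v → firstBelow x v j (suc n) ≡ j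
firstBelow-hit x {v} j n x<v rewrite dec-true (x j <? v) x<v = refl

firstBelow-miss : ∀ x {v} j n → ¬ x j < v → firstBelow x v j (suc n) ≡ firstBelow x v (suc j) n
firstBelow-miss x {v} j n x≮v rewrite dec-false (x j <? v) x≮v = refl

firstBelow-cong : ∀ {x y} v j n → (∀ l → j ≤ l → y l ≡ x l) → firstBelow y v j n ≡ firstBelow x v j n
firstBelow-cong v j zero y≗x = refl
firstBelow-cong {x} v j (suc n) y≗x rewrite y≗x j ≤-refl =
  cong (if does (x j <? v) then j else_)
       (firstBelow-cong v (suc j) n λ l j<l → y≗x l (<⇒≤ j<l))

-- Truncated subtraction turns the sentinel 0 of firstBelow into the distance 0.
revSearch≡firstBelow∸ : ∀ x h j n → revSearch x h j n ≡ firstBelow x (x h) j n ∸ h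
revSearch≡firstBelow∸ x h j zero = sym (0∸n≡0 h)
revSearch≡firstBelow∸ x h j (suc n) with does (x j <? x h)
... | true = refl
... | false = revSearch≡firstBelow∸ x h (suc j) n

fwdPD-τ-at : ∀ x k →
  fwdPD (τ x (suc k)) (suc k) ≡ fwdDistance (suc k) (lastBelow x (x (suc (suc k))) k)
fwdPD-τ-at x k = begin
  fwdPD y i
    ≡⟨ fwdSearch≡fwdDistance y i k ⟩
  fwdDistance i (lastBelow y (y i) k)
    ≡⟨ cong (λ v → fwdDistance i (lastBelow y v k)) (τ-at x i) ⟩
  fwdDistance i (lastBelow y (x (suc i)) k)
    ≡⟨ cong (fwdDistance i) (lastBelow-cong _ k λ _ j≤k → τ-before x (s≤s j≤k)) ⟩
  fwdDistance i (lastBelow x (x (suc i)) k) ∎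
  where
  open ≡-Reasoning
  i : ℕ
  i = suc k
  y : ℕ → ℤ
  y = τ x i

fwdPD-τ-suc : ∀ x k → ¬ x (suc (suc k)) < x (suc k) →
  fwdPD (τ x (suc k)) (suc (suc k)) ≡ fwdDistance (suc (suc k)) (lastBelow x (x (suc k)) k)
fwdPD-τ-suc x k x≮x = begin
  fwdPD y (suc i)
    ≡⟨ fwdSearch≡fwdDistance y (suc i) i ⟩
  fwdDistance (suc i) (lastBelow y (y (suc i)) i)
    ≡⟨ cong (λ v → fwdDistance (suc i) (lastBelow y v i)) (τ-at-suc x i) ⟩
  fwdDistance (suc i) (lastBelow y (x i) i)
    ≡⟨ cong (fwdDistance (suc i)) (lastBelow-miss y (x i) k y≮x) ⟩
  fwdDistance (suc i) (lastBelow y (x i) k)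
    ≡⟨ cong (fwdDistance (suc i)) (lastBelow-cong _ k λ _ j≤k → τ-before x (s≤s j≤k)) ⟩
  fwdDistance (suc i) (lastBelow x (x i) k) ∎
  where
  open ≡-Reasoning
  i : ℕ
  i = suc k
  y : ℕ → ℤ
  y = τ x i
  y≮x : ¬ y i < x i
  y≮x rewrite τ-at x i = x≮x

revPD≡firstBelow∸ : ∀ m x i → suc i ≤ m →
  revPD m x i ≡ firstBelow x (x i) (suc i) (suc (m ∸ suc i)) ∸ i
revPD≡firstBelow∸ m x i i<m =
  trans (cong (revSearch x i (suc i)) (+-∸-assoc 1 i<m))
        (revSearch≡firstBelow∸ x i (suc i) (suc (m ∸ suc i)))

revPD-τ-at : ∀ m x i → suc i ≤ m → x i < x (suc i) → revPD m (τ x i) i ≡ 1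
revPD-τ-at m x i i<m x<x = begin
  revPD m y i                                     ≡⟨ revPD≡firstBelow∸ m y i i<m ⟩
  firstBelow y (y i) (suc i) (suc (m ∸ suc i)) ∸ i ≡⟨ cong (_∸ i) (firstBelow-hit y (suc i) (m ∸ suc i) y<y) ⟩
  suc i ∸ i                                       ≡⟨ m+n∸n≡m 1 i ⟩
  1                                               ∎
  where
  open ≡-Reasoning
  y : ℕ → ℤ
  y = τ x i
  y<y : y (suc i) < y i
  y<y rewrite τ-at x i | τ-at-suc x i = x<x

revPD-skip : ∀ m x i → suc i ≤ m → ¬ x (suc i) < x i →
  revPD m x i ≡ firstBelow x (x i) (suc (suc i)) (m ∸ suc i) ∸ i
revPD-skip m x i i<m x≮x =
  trans (revPD≡firstBelow∸ m x i i<m) (cong (_∸ i) (firstBelow-miss x (suc i) (m ∸ suc i) x≮x))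

revPD-τ-suc : ∀ m x i → suc i ≤ m → ¬ x (suc i) < x i → revPD m (τ x i) (suc i) ≡ revPD m x i ∸ 1
revPD-τ-suc m x i i<m x≮x = begin
  revPD m y (suc i)                      ≡⟨ revSearch≡firstBelow∸ y (suc i) (suc (suc i)) r ⟩
  firstBelow y (y (suc i)) (suc (suc i)) r ∸ suc i
    ≡⟨ cong (λ v → firstBelow y v (suc (suc i)) r ∸ suc i) (τ-at-suc x i) ⟩
  firstBelow y (x i) (suc (suc i)) r ∸ suc i
    ≡⟨ cong (_∸ suc i) (firstBelow-cong (x i) (suc (suc i)) r λ _ 1+i<l → τ-after x 1+i<l) ⟩
  q ∸ suc i                              ≡⟨ cong (q ∸_) (+-comm 1 i) ⟩
  q ∸ (i + 1)                            ≡⟨ ∸-+-assoc q i 1 ⟨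
  q ∸ i ∸ 1                              ≡⟨ cong (_∸ 1) (revPD-skip m x i i<m x≮x) ⟨
  revPD m x i ∸ 1                        ∎
  where
  open ≡-Reasoning
  y : ℕ → ℤ
  y = τ x i
  r : ℕ
  r = m ∸ suc i
  q : ℕ
  q = firstBelow x (x i) (suc (suc i)) r

lemma3 : (m : ℕ) (x : ℕ → ℤ) (i : ℕ) →
  (∀ j k → 1 ≤ j → j ≤ m → 1 ≤ k → k ≤ m → x j ≡ x k → j ≡ k) →
  1 ≤ i → suc i ≤ m →
  x i < x (suc i) →
  (revPD m (τ x i) i ≡ 1)
  × ((fwdPD x i ≡ 0 → fwdPD (τ x i) (suc i) ≡ 0)
     × (¬ fwdPD x i ≡ 0 → fwdPD (τ x i) (suc i) ≡ suc (fwdPD x i)))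
  × ((revPD m x i ≡ 0 → revPD m (τ x i) (suc i) ≡ 0)
     × (¬ revPD m x i ≡ 0 → revPD m (τ x i) (suc i) ≡ revPD m x i ∸ 1))
  × ((fwdPD x i ≡ 0 → fwdPD (τ x i) i ≤ i ∸ 1)
     × (¬ fwdPD x i ≡ 0 → fwdPD (τ x i) i ≤ fwdPD x i))
lemma3 m x i@(suc k) _ (s≤s z≤n) i<m x<x
  rewrite revPD-τ-at m x i i<m x<x
        | revPD-τ-suc m x i i<m (ℤ.<-asym x<x)
        | fwdPD-τ-suc x k (ℤ.<-asym x<x)
        | fwdPD-τ-at x k
        | fwdSearch≡fwdDistance x i k =
    refl
  , ( (λ d≡0 → cong (fwdDistance (suc i)) (fwdDistance≡0 (s≤s p≤k) d≡0))
    , (λ d≢0 → fwdDistance-suc d≢0 (m≤n⇒m≤1+n p≤k)))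
  , (cong (_∸ 1) , λ _ → refl)
  , ( (λ _ → fwdDistance≤pred i (lastBelow x (x (suc i)) k))
    , (λ d≢0 → fwdDistance-antitone d≢0 (lastBelow-mono x k x<x)))
  where
  p≤k : lastBelow x (x i) k ≤ k
  p≤k = lastBelow≤ x (x i) k
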